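{- Let $\mathcal T$ be a perfect topology on $\mathbb N$ such that for every $n\in\mathbb N$, the family $\mathcal T^*(n)=\{V\setminus\{n\}: V\in\mathcal T,\ n\in V\}$ is a basis for an ultrafilter on $\mathbb N\setminus\{n\}$. Then $\mathcal T$ is a maximal perfect topology.
   Context: A topology is \emph{perfect} if every non-empty open set is infinite. A perfect topology $\mathcal T$ on a set $U$ is a \emph{maximal perfect topology} if no topology on $U$ strictly finer than $\mathcal T$ is perfect. -}

module Defs where

open import Level using (0ℓ)
open import Data.Nat using (ℕ)
open import Data.List using (List)
open import Data.List.Membership.Propositional using (_∈_)
open import Data.Product using (Σ; ∃; _×_)
open import Data.Sum using (_⊎_)
open import Relation.Nullary using (¬_)
open import Relation.Unary using (Pred; ∅; U; _⊆_; _≐_; _∩_; _∖_; ｛_｝; Satisfiable)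

Subset : Set₁
Subset = Pred ℕ 0ℓ

Family : Set₁
Family = Subset → Set

-- The union of a subfamily 𝒜 ⊆ 𝒯 is any set W
-- having exactly the points lying in some member of 𝒜.
record IsTopology (𝒯 : Family) : Set₁ where
  field
    empty-open : 𝒯 ∅
    whole-open : 𝒯 U
    ∩-open     : ∀ {A B} → 𝒯 A → 𝒯 B → 𝒯 (A ∩ B)
    ⋃-open     : (𝒜 : Family) (W : Subset) →
                 (∀ V → 𝒜 V → 𝒯 V) →
                 W ≐ (λ x → Σ Subset (λ V → 𝒜 V × V x)) →
                 𝒯 W

Finite : Subset → Set
Finite A = ∃ λ (xs : List ℕ) → ∀ {x} → A x → x ∈ xs

Infinite : Subset → Set
Infinite A = ¬ Finite A

Perfect : Family → Set₁
Perfect 𝒯 = ∀ V → 𝒯 V → Satisfiable V → Infinite V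

StrictlyFiner : Family → Family → Set₁
StrictlyFiner 𝒯 𝒯' = (∀ V → 𝒯 V → 𝒯' V) × Σ Subset (λ V → 𝒯' V × ¬ 𝒯 V)

MaximalPerfect : Family → Set₁
MaximalPerfect 𝒯 =
  IsTopology 𝒯 × Perfect 𝒯 ×
  (∀ (𝒯' : Family) → IsTopology 𝒯' → StrictlyFiner 𝒯 𝒯' → ¬ Perfect 𝒯')

record IsFilter (X : Subset) (F : Family) : Set₁ where
  field
    ⊆X     : ∀ A → F A → A ⊆ X
    X∈F    : F X
    proper : ¬ F ∅
    upward : ∀ {A B} → F A → A ⊆ B → B ⊆ X → F B
    ∩-mem  : ∀ {A B} → F A → F B → F (A ∩ B)

IsUltrafilter : Subset → Family → Set₁
IsUltrafilter X F = IsFilter X F × (∀ A → A ⊆ X → F A ⊎ F (X ∖ A))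

IsBasisOf : (Subset → Set₁) → Family → Set₁
IsBasisOf 𝓑 F = (∀ B → 𝓑 B → F B) × (∀ A → F A → Σ Subset (λ B → 𝓑 B × B ⊆ A))

IsUltrafilterBasis : Subset → (Subset → Set₁) → Set₁
IsUltrafilterBasis X 𝓑 = Σ Family (λ F → IsUltrafilter X F × IsBasisOf 𝓑 F)

TStar : Family → ℕ → Subset → Set₁
TStar 𝒯 n B = Σ Subset (λ V → 𝒯 V × V n × B ≐ (V ∖ ｛ n ｝))

{-# OPTIONS --safe #-}
module Submission where

-- If a perfect topology 𝒯' refines 𝒯 and W is 𝒯'-open with x ∈ W, the ultrafilter generated
-- by 𝒯*(x) contains W ∖ {x} or its complement.  In the second case some 𝒯-open V ∋ x meets W
-- only in x, so V ∩ W is a non-empty finite 𝒯'-open set, contradicting perfectness.  Hence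
-- the first case holds, giving a 𝒯-open V with x ∈ V ⊆ W; so W is 𝒯-open and 𝒯' = 𝒯.

open import Defs
open import Data.Nat using (ℕ; _≟_)
open import Data.Product using (Σ; _×_; _,_; proj₁; proj₂)
open import Data.Sum using (_⊎_; inj₁; inj₂)
open import Data.Empty using (⊥-elim)
open import Data.List using ([_])
open import Data.List.Relation.Unary.Any using (here)
open import Relation.Nullary using (¬_; yes; no; contradiction)
open import Relation.Unary using (U; ∁; _∖_; ｛_｝; _∩_; _⊆_)
open import Relation.Binary.PropositionalEquality using (refl; sym)

⊆-singleton⇒Finite : ∀ {A x} → A ⊆ ｛ x ｝ → Finite A
⊆-singleton⇒Finite {x = x} A⊆x = [ x ] , λ Ay → here (sym (A⊆x Ay))

Perfect⇒¬⊆-singleton : ∀ {𝒯 A x} → Perfect 𝒯 → 𝒯 A → A x → ¬ A ⊆ ｛ x ｝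
Perfect⇒¬⊆-singleton perf A-open Ax A⊆x =
  perf _ A-open (_ , Ax) (⊆-singleton⇒Finite A⊆x)

locallyOpen⇒open : ∀ {𝒯 W} → IsTopology 𝒯 →
                   (∀ {x} → W x → Σ Subset λ V → 𝒯 V × V x × V ⊆ W) → 𝒯 W
locallyOpen⇒open {𝒯} {W} top nbhd =
  IsTopology.⋃-open top (λ V → 𝒯 V × V ⊆ W) W (λ _ → proj₁) (covered , inside)
  where
  covered : ∀ {x} → W x → Σ Subset λ V → (𝒯 V × V ⊆ W) × V x
  covered Wx with nbhd Wx
  ... | V , V-open , Vx , V⊆W = V , (V-open , V⊆W) , Vx

  inside : ∀ {x} → (Σ Subset λ V → (𝒯 V × V ⊆ W) × V x) → W x
  inside (_ , (_ , V⊆W) , Vx) = V⊆W Vx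

UltrafilterBasis-dichotomy : ∀ {X 𝓑} → IsUltrafilterBasis X 𝓑 → ∀ A → A ⊆ X →
                             Σ Subset λ B → 𝓑 B × (B ⊆ A ⊎ B ⊆ X ∖ A)
UltrafilterBasis-dichotomy (F , (_ , ultra) , (_ , refines)) A A⊆X with ultra A A⊆X
... | inj₁ FA with refines _ FA
...   | B , 𝓑B , B⊆A = B , 𝓑B , inj₁ B⊆A
UltrafilterBasis-dichotomy (F , (_ , ultra) , (_ , refines)) A A⊆X | inj₂ FX∖A
  with refines _ FX∖A
...   | B , 𝓑B , B⊆X∖A = B , 𝓑B , inj₂ B⊆X∖A

module _ {V W : Subset} {x : ℕ} where

  punctured⊆⇒⊆ : W x → V ∖ ｛ x ｝ ⊆ W → V ⊆ W
  punctured⊆⇒⊆ Wx V∖x⊆W {y} Vy with x ≟ y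
  ... | yes refl = Wx
  ... | no x≢y   = V∖x⊆W (Vy , x≢y)

  punctured⊆∁⇒∩⊆singleton : V ∖ ｛ x ｝ ⊆ ∁ (W ∖ ｛ x ｝) → V ∩ W ⊆ ｛ x ｝
  punctured⊆∁⇒∩⊆singleton V∖x⊆∁W∖x {y} (Vy , Wy) with x ≟ y
  ... | yes x≡y = x≡y
  ... | no x≢y  = contradiction (Wy , x≢y) (V∖x⊆∁W∖x (Vy , x≢y))

perfectRefinement-open⇒locallyOpen : ∀ {𝒯 𝒯' W x} →
  IsUltrafilterBasis (U ∖ ｛ x ｝) (TStar 𝒯 x) → IsTopology 𝒯' → Perfect 𝒯' →
  (∀ V → 𝒯 V → 𝒯' V) → 𝒯' W → W x → Σ Subset λ V → 𝒯 V × V x × V ⊆ W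
perfectRefinement-open⇒locallyOpen {W = W} {x} ult top' perf' coarser W-open Wx
  with UltrafilterBasis-dichotomy ult (W ∖ ｛ x ｝) (λ (_ , x≢y) → _ , x≢y)
... | B , (V , V-open , Vx , B≐V∖x) , inj₁ B⊆W∖x =
  V , V-open , Vx , punctured⊆⇒⊆ Wx (λ p → proj₁ (B⊆W∖x (proj₂ B≐V∖x p)))
... | B , (V , V-open , Vx , B≐V∖x) , inj₂ B⊆∁W∖x =
  ⊥-elim (Perfect⇒¬⊆-singleton perf' (IsTopology.∩-open top' (coarser V V-open) W-open)
            (Vx , Wx) (punctured⊆∁⇒∩⊆singleton λ p → proj₂ (B⊆∁W∖x (proj₂ B≐V∖x p))))

mainTheorem9 : (𝒯 : Family) → IsTopology 𝒯 → Perfect 𝒯 →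
    ((n : ℕ) → IsUltrafilterBasis (U ∖ ｛ n ｝) (TStar 𝒯 n)) →
    MaximalPerfect 𝒯
mainTheorem9 𝒯 top perf ult = top , perf , noPerfectRefinement
  where
  noPerfectRefinement : ∀ 𝒯' → IsTopology 𝒯' → StrictlyFiner 𝒯 𝒯' → ¬ Perfect 𝒯'
  noPerfectRefinement 𝒯' top' (coarser , W , W-open' , W∉𝒯) perf' =
    W∉𝒯 (locallyOpen⇒open top λ Wx → perfectRefinement-open⇒locallyOpen (ult _) top' perf' coarser W-open' Wx)
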